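{- Let $a$ be an odd positive integer. A positive integer $m$ can be expressed in the form $ax+(a+2)y$ with $x,y$ nonnegative integers if and only if one of the following holds: (1) $m \bmod a$ is even and $\left\lfloor\frac{m}{a}\right\rfloor\ge\frac{m}{a+2}$; (2) $m \bmod a$ is odd and $\left\lfloor\frac{m}{a}\right\rfloor\ge\frac{m}{a+2}+1$.
   Context: Here $m \bmod a$ denotes the remainder of $m$ upon division by $a$, in $\{0,1,\ldots,a-1\}$. -}

module Defs where

open import Data.Nat using (ℕ; suc; _+_; _*_)
open import Data.Nat.Divisibility using (_∣_)
open import Data.Product using (Σ)
open import Relation.Nullary using (¬_)
open import Relation.Binary.PropositionalEquality using (_≡_)

Even : ℕ → Set
Even n = 2 ∣ n

Odd : ℕ → Set
Odd n = ¬ (2 ∣ n)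

Representable : ℕ → ℕ → Set
Representable a m = Σ ℕ λ x → Σ ℕ λ y → a * x + (a + 2) * y ≡ m

{-# OPTIONS --safe #-}
module Submission where

-- Since a x + (a + 2) y = 2 y + (x + y) a, the representable m are exactly the numbers
-- 2 y + n a with y ≤ n.  Compared with m = r + q a (r = m % a, q = m / a), such a form has
-- n ≤ q, and n = q forces 2 y = r.  So the best choice is y = r / 2, n = q when r is even
-- and, a being odd, y = (r + a) / 2, n = q - 1 when r is odd; the condition y ≤ n then
-- reads r ≤ 2 q, resp. r + a + 2 ≤ 2 q, i.e. the stated inequalities times a + 2.

open import Defs

module Representability where
  open import Data.Nat
  open import Data.Nat.Properties
  open import Data.Nat.DivMod
  open import Data.Nat.Divisibility
  open import Data.Nat.Tactic.RingSolver
  open import Data.Product using (_×_; _,_)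
  open import Data.Sum using (_⊎_; inj₁; inj₂)
  open import Function.Bundles using (_⇔_; mk⇔)
  open import Relation.Nullary using (yes; no; contradiction)
  open import Relation.Binary.PropositionalEquality
  open import Algebra.Properties.CommutativeSemigroup +-commutativeSemigroup using (xy∙z≈y∙xz)

  odd⇒%2≡1 : ∀ {n} → Odd n → n % 2 ≡ 1
  odd⇒%2≡1 {n} odd with n % 2 | m%n<n n 2 | m%n≡0⇒n∣m n 2
  ... | 0 | _ | even = contradiction (even refl) odd
  ... | 1 | _ | _    = refl
  ... | suc (suc _) | s≤s (s≤s ()) | _

  odd+odd⇒even : ∀ {m n} → Odd m → Odd n → Even (m + n)
  odd+odd⇒even {m} {n} odd-m odd-n = m%n≡0⇒n∣m (m + n) 2 (begin
    (m + n) % 2           ≡⟨ %-distribˡ-+ m n 2 ⟩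
    (m % 2 + n % 2) % 2   ≡⟨ cong₂ (λ i j → (i + j) % 2) (odd⇒%2≡1 odd-m) (odd⇒%2≡1 odd-n) ⟩
    (1 + 1) % 2           ≡⟨⟩
    0                     ∎)
    where open ≡-Reasoning

  m*n≤o⇒m≤o/n : ∀ {m n o} .{{_ : NonZero n}} → m * n ≤ o → m ≤ o / n
  m*n≤o⇒m≤o/n {m} {n} {o} m*n≤o = subst (_≤ o / n) (m*n/n≡m m n) (/-monoˡ-≤ n m*n≤o)

  representation-identity : ∀ a x y → a * x + (a + 2) * y ≡ y * 2 + (y + x) * a
  representation-identity = solve-∀

  y*2+n*a≤n*[2+a] : ∀ {y n} a → y ≤ n → y * 2 + n * a ≤ n * (2 + a)
  y*2+n*a≤n*[2+a] {y} {n} a y≤n = begin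
    y * 2 + n * a  ≤⟨ +-monoˡ-≤ (n * a) (*-monoˡ-≤ 2 y≤n) ⟩
    n * 2 + n * a  ≡⟨ *-distribˡ-+ n 2 a ⟨
    n * (2 + a)    ∎
    where open ≤-Reasoning

  Criterion : (a m : ℕ) .{{_ : NonZero a}} → Set
  Criterion a m = (Even (m % a) × m ≤ m / a * (2 + a))
                ⊎ (Odd (m % a) × m + (2 + a) ≤ m / a * (2 + a))

  module _ {a m : ℕ} .{{_ : NonZero a}} where

    y*2+n*a≡m⇒n≤m/a : ∀ y n → y * 2 + n * a ≡ m → n ≤ m / a
    y*2+n*a≡m⇒n≤m/a y n eq =
      m*n≤o⇒m≤o/n (subst (n * a ≤_) eq (m≤n+m (n * a) (y * 2)))

    y*2+n*a≡m⇒n<m/a : ∀ y n → y * 2 + n * a ≡ m → Odd (m % a) → n < m / a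
    y*2+n*a≡m⇒n<m/a y n eq odd with m≤n⇒m<n∨m≡n (y*2+n*a≡m⇒n≤m/a y n eq)
    ... | inj₁ n<m/a = n<m/a
    ... | inj₂ refl = contradiction (divides y (+-cancelʳ-≡ (n * a) (m % a) (y * 2) (begin
      m % a + n * a  ≡⟨ m≡m%n+[m/n]*n m a ⟨
      m              ≡⟨ eq ⟨
      y * 2 + n * a  ∎))) odd
      where open ≡-Reasoning

    criterion-intro : ∀ y n → y ≤ n → y * 2 + n * a ≡ m → Criterion a m
    criterion-intro y n y≤n eq with 2 ∣? m % a
    ... | yes even = inj₁ (even , (begin
      m                ≡⟨ eq ⟨
      y * 2 + n * a    ≤⟨ y*2+n*a≤n*[2+a] a y≤n ⟩
      n * (2 + a)      ≤⟨ *-monoˡ-≤ (2 + a) (y*2+n*a≡m⇒n≤m/a y n eq) ⟩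
      m / a * (2 + a)  ∎))
      where open ≤-Reasoning
    ... | no odd = inj₂ (odd , (begin
      m + (2 + a)            ≡⟨ cong (_+ (2 + a)) eq ⟨
      y * 2 + n * a + (2 + a) ≤⟨ +-monoˡ-≤ (2 + a) (y*2+n*a≤n*[2+a] a y≤n) ⟩
      n * (2 + a) + (2 + a)  ≡⟨ +-comm (n * (2 + a)) (2 + a) ⟩
      suc n * (2 + a)        ≤⟨ *-monoˡ-≤ (2 + a) (y*2+n*a≡m⇒n<m/a y n eq odd) ⟩
      m / a * (2 + a)        ∎))
      where open ≤-Reasoning

    representable-intro : ∀ y n → y ≤ n → y * 2 + n * a ≡ m → Representable a m
    representable-intro y n y≤n eq = n ∸ y , y , (begin
      a * (n ∸ y) + (a + 2) * y  ≡⟨ representation-identity a (n ∸ y) y ⟩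
      y * 2 + (y + (n ∸ y)) * a  ≡⟨ cong (λ k → y * 2 + k * a) (m+[n∸m]≡n y≤n) ⟩
      y * 2 + n * a              ≡⟨ eq ⟩
      m                          ∎)
      where open ≡-Reasoning

    c+m≤[m/a]*[2+a]⇒c+m%a≤[m/a]*2 : ∀ c →
      c + m ≤ m / a * (2 + a) → c + m % a ≤ m / a * 2
    c+m≤[m/a]*[2+a]⇒c+m%a≤[m/a]*2 c le =
      +-cancelʳ-≤ (m / a * a) (c + m % a) (m / a * 2) (begin
      c + m % a + m / a * a    ≡⟨ +-assoc c (m % a) (m / a * a) ⟩
      c + (m % a + m / a * a)  ≡⟨ cong (c +_) (m≡m%n+[m/n]*n m a) ⟨
      c + m                    ≤⟨ le ⟩
      m / a * (2 + a)          ≡⟨ *-distribˡ-+ (m / a) 2 a ⟩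
      m / a * 2 + m / a * a    ∎)
      where open ≤-Reasoning

    criterion⇒representable : Odd a → Criterion a m → Representable a m
    criterion⇒representable _ (inj₁ (divides j r≡j*2 , le)) =
      representable-intro j (m / a) j≤q (begin
        j * 2 + m / a * a    ≡⟨ cong (_+ m / a * a) r≡j*2 ⟨
        m % a + m / a * a    ≡⟨ m≡m%n+[m/n]*n m a ⟨
        m                    ∎)
      where
      open ≡-Reasoning
      j≤q : j ≤ m / a
      j≤q = *-cancelʳ-≤ j (m / a) 2
        (subst (_≤ m / a * 2) r≡j*2 (c+m≤[m/a]*[2+a]⇒c+m%a≤[m/a]*2 0 le))
    criterion⇒representable odd-a (inj₂ (odd-r , le))
      with odd+odd⇒even odd-a odd-r | m / a | m≡m%n+[m/n]*n m a
         | c+m≤[m/a]*[2+a]⇒c+m%a≤[m/a]*2 (2 + a)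
             (subst (_≤ m / a * (2 + a)) (+-comm m (2 + a)) le)
    ... | divides j a+r≡j*2 | zero  | _      | ()
    ... | divides j a+r≡j*2 | suc n | m≡r+qa | s≤s (s≤s bound) =
      representable-intro j n j≤n (begin
        j * 2 + n * a          ≡⟨ cong (_+ n * a) a+r≡j*2 ⟨
        a + m % a + n * a      ≡⟨ xy∙z≈y∙xz a (m % a) (n * a) ⟩
        m % a + suc n * a      ≡⟨ m≡r+qa ⟨
        m                      ∎)
      where
      open ≡-Reasoning
      j≤n : j ≤ n
      j≤n = *-cancelʳ-≤ j n 2 (subst (_≤ n * 2) a+r≡j*2 bound)

  representable⇔criterion : ∀ {a m} .{{_ : NonZero a}} →
    Odd a → Representable a m ⇔ Criterion a m
  representable⇔criterion {a} odd-a = mk⇔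
    (λ (x , y , eq) →
      criterion-intro y (y + x) (m≤m+n y x) (trans (sym (representation-identity a x y)) eq))
    (criterion⇒representable odd-a)

module FractionComparison where
  open import Data.Nat as ℕ using (ℕ; suc)
  import Data.Nat.Properties as ℕ
  open import Data.Integer as ℤ using (+_)
  import Data.Integer.Properties as ℤ
  open import Data.Integer.Tactic.RingSolver using (solve-∀)
  open import Data.Rational using (_≤_; _+_; _/_; 1ℚ; toℚᵘ)
  open import Data.Rational.Properties
    using (toℚᵘ-fromℚᵘ; toℚᵘ-mono-≤; toℚᵘ-cancel-≤; toℚᵘ-injective; toℚᵘ-homo-+)
  open import Data.Rational.Unnormalised as ℚᵘ using (mkℚᵘ; *≡*; *≤*)
  import Data.Rational.Unnormalised.Properties as ℚᵘ
  open import Function.Base using (_∘_)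
  open import Function.Bundles using (_⇔_; mk⇔; Equivalence)
  open import Relation.Binary.PropositionalEquality

  toℚᵘ-/ : ∀ m d → toℚᵘ (+ m / suc d) ℚᵘ.≃ mkℚᵘ (+ m) d
  toℚᵘ-/ m d = toℚᵘ-fromℚᵘ (mkℚᵘ (+ m) d)

  mkℚᵘ-≤⇔ : ∀ m d q e →
    (mkℚᵘ (+ m) d ℚᵘ.≤ mkℚᵘ (+ q) e) ⇔ (m ℕ.* suc e ℕ.≤ q ℕ.* suc d)
  mkℚᵘ-≤⇔ m d q e = mk⇔
    (λ le → ℤ.drop‿+≤+ (subst₂ ℤ._≤_ (sym lhs) (sym rhs) (ℚᵘ.drop-*≤* le)))
    (λ le → *≤* (subst₂ ℤ._≤_ lhs rhs (ℤ.+≤+ le)))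
    where
    lhs : + (m ℕ.* suc e) ≡ + m ℤ.* + suc e
    lhs = ℤ.pos-* m (suc e)
    rhs : + (q ℕ.* suc d) ≡ + q ℤ.* + suc d
    rhs = ℤ.pos-* q (suc d)

  /-≤-/⇔ : ∀ m d q e → (+ m / suc d ≤ + q / suc e) ⇔ (m ℕ.* suc e ℕ.≤ q ℕ.* suc d)
  /-≤-/⇔ m d q e = mk⇔
    (Equivalence.to (mkℚᵘ-≤⇔ m d q e) ∘ to) (from ∘ Equivalence.from (mkℚᵘ-≤⇔ m d q e))
    where
    x = + m / suc d
    y = + q / suc e
    to : x ≤ y → mkℚᵘ (+ m) d ℚᵘ.≤ mkℚᵘ (+ q) e
    to le = ℚᵘ.≤-respʳ-≃ (toℚᵘ-/ q e) (ℚᵘ.≤-respˡ-≃ (toℚᵘ-/ m d) (toℚᵘ-mono-≤ le))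
    from : mkℚᵘ (+ m) d ℚᵘ.≤ mkℚᵘ (+ q) e → x ≤ y
    from le = toℚᵘ-cancel-≤
      (ℚᵘ.≤-respʳ-≃ (ℚᵘ.≃-sym (toℚᵘ-/ q e)) (ℚᵘ.≤-respˡ-≃ (ℚᵘ.≃-sym (toℚᵘ-/ m d)) le))

  mkℚᵘ+1≃ : ∀ m d → mkℚᵘ (+ m) d ℚᵘ.+ ℚᵘ.1ℚᵘ ℚᵘ.≃ mkℚᵘ (+ (m ℕ.+ suc d)) d
  mkℚᵘ+1≃ m d = *≡* (begin
    (+ m ℤ.* + 1 ℤ.+ + 1 ℤ.* + suc d) ℤ.* + suc d  ≡⟨ identity (+ m) (+ suc d) ⟩
    (+ m ℤ.+ + suc d) ℤ.* (+ suc d ℤ.* + 1)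
      ≡⟨ cong₂ ℤ._*_ (ℤ.pos-+ m (suc d)) (ℤ.pos-* (suc d) 1) ⟨
    + (m ℕ.+ suc d) ℤ.* + (suc d ℕ.* 1)            ∎)
    where
    open ≡-Reasoning
    identity : ∀ i k → (i ℤ.* + 1 ℤ.+ + 1 ℤ.* k) ℤ.* k ≡ (i ℤ.+ k) ℤ.* (k ℤ.* + 1)
    identity = solve-∀

  /+1≡ : ∀ m d → + m / suc d + 1ℚ ≡ + (m ℕ.+ suc d) / suc d
  /+1≡ m d = toℚᵘ-injective (begin
    toℚᵘ (+ m / suc d + 1ℚ)         ≈⟨ toℚᵘ-homo-+ (+ m / suc d) 1ℚ ⟩
    toℚᵘ (+ m / suc d) ℚᵘ.+ ℚᵘ.1ℚᵘ  ≈⟨ ℚᵘ.+-congˡ ℚᵘ.1ℚᵘ (toℚᵘ-/ m d) ⟩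
    mkℚᵘ (+ m) d ℚᵘ.+ ℚᵘ.1ℚᵘ        ≈⟨ mkℚᵘ+1≃ m d ⟩
    mkℚᵘ (+ (m ℕ.+ suc d)) d        ≈⟨ toℚᵘ-/ (m ℕ.+ suc d) d ⟨
    toℚᵘ (+ (m ℕ.+ suc d) / suc d)  ∎)
    where open ℚᵘ.≃-Reasoning

  /-≤-/1⇔ : ∀ m d q → (+ m / suc d ≤ + q / 1) ⇔ (m ℕ.≤ q ℕ.* suc d)
  /-≤-/1⇔ m d q =
    subst (λ k → (+ m / suc d ≤ + q / 1) ⇔ (k ℕ.≤ q ℕ.* suc d)) (ℕ.*-identityʳ m) (/-≤-/⇔ m d q 0)

  /+1-≤-/1⇔ : ∀ m d q → (+ m / suc d + 1ℚ ≤ + q / 1) ⇔ (m ℕ.+ suc d ℕ.≤ q ℕ.* suc d)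
  /+1-≤-/1⇔ m d q rewrite /+1≡ m d = /-≤-/1⇔ (m ℕ.+ suc d) d q

open import Data.Nat using (ℕ; suc; NonZero; _%_; _/_)
open import Data.Integer using (+_)
open import Data.Rational using (ℚ; _≤_; _+_; 1ℚ)
open import Data.Sum using (_⊎_)
open import Data.Product using (_×_)
open import Function.Bundles using (_⇔_)
import Data.Rational as Q

open import Data.Sum.Function.Propositional using (_⊎-⇔_)
open import Data.Product.Function.NonDependent.Propositional using (_×-⇔_)
open import Function.Construct.Composition using (_⇔-∘_)
open import Function.Construct.Identity using (⇔-id)
open import Function.Construct.Symmetry using (⇔-sym)
open Representability using (representable⇔criterion)
open FractionComparison using (/-≤-/1⇔; /+1-≤-/1⇔)

lemma8 : (a : ℕ) → .{{_ : NonZero a}} → Odd a → (m : ℕ) → .{{_ : NonZero m}} →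
    Representable a m ⇔
      ((Even (m % a) × Q._/_ (+ m) (suc (suc a)) ≤ Q._/_ (+ (m / a)) 1)
      ⊎ (Odd (m % a) × Q._/_ (+ m) (suc (suc a)) + 1ℚ ≤ Q._/_ (+ (m / a)) 1))
lemma8 a odd-a m =
  ((⇔-id _ ×-⇔ ⇔-sym (/-≤-/1⇔ m (suc a) (m / a)))
    ⊎-⇔ (⇔-id _ ×-⇔ ⇔-sym (/+1-≤-/1⇔ m (suc a) (m / a))))
  ⇔-∘ representable⇔criterion odd-a
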